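{- There exists a quadratic word equation whose length abstraction is not Presburger-definable.
   Context: Fix disjoint sets $A$ (a finite alphabet of constants) and $V$ (variables). A word equation is an expression $L = R$ with $L,R \in (A\cup V)^*$. A solution is a homomorphism $\sigma : (A\cup V)^* \to A^*$ fixing every constant $a\in A$ such that $\sigma(L)=\sigma(R)$. The equation is quadratic if each variable occurs at most twice in $L R$ in total. If $x_1,\dots,x_k$ (in a fixed order) are the variables of the equation $E$, its length abstraction is $\mathrm{Len}(E)=\{(|\sigma(x_1)|,\dots,|\sigma(x_k)|) : \sigma \text{ a solution of } E\}\subseteq \mathbb{N}^k$. A set $S\subseteq\mathbb{N}^k$ is Presburger-definable if it is definable by a first-order formula of Presburger arithmetic (the first-order theory of the natural numbers with addition and order). -}

module Defs where

open import Data.Nat using (ℕ; _+_; _≤_) renaming (suc to sucℕ)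
open import Data.Fin using (Fin; zero; suc)
open import Data.List using (List; []; _∷_; _++_; length)
open import Data.Sum using (_⊎_; inj₁; inj₂)
open import Data.Product using (Σ; _×_; _,_; ∃)
open import Data.Empty using (⊥)
open import Data.Unit using (⊤)
open import Relation.Nullary using (¬_)
open import Relation.Binary.PropositionalEquality using (_≡_)
open import Function.Bundles using (_⇔_)
open import Data.Fin using (_≟_)
open import Relation.Nullary using (yes; no)
open import Data.List.Membership.Propositional using (_∈_)
open import Data.List.Relation.Unary.Any using ()

-- Word equations over the constant alphabet A = Fin n with variables
-- V = Fin k (disjoint via the sum type).

Letter : ℕ → ℕ → Set
Letter n k = Fin n ⊎ Fin k

Word : ℕ → ℕ → Set
Word n k = List (Letter n k)

record WordEquation (n k : ℕ) : Set where
  constructor _≐_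
  field
    lhs : Word n k
    rhs : Word n k
open WordEquation public

-- A homomorphism (A ∪ V)* → A* fixing constants is determined by the
-- images of the variables.
Assignment : ℕ → ℕ → Set
Assignment n k = Fin k → List (Fin n)

apply : ∀ {n k} → Assignment n k → Word n k → List (Fin n)
apply σ []            = []
apply σ (inj₁ a ∷ w)  = a ∷ apply σ w
apply σ (inj₂ x ∷ w)  = σ x ++ apply σ w

IsSolution : ∀ {n k} → WordEquation n k → Assignment n k → Set
IsSolution E σ = apply σ (lhs E) ≡ apply σ (rhs E)

occ : ∀ {n k} → Fin k → Word n k → ℕ
occ x [] = 0
occ x (inj₁ a ∷ w) = occ x w
occ x (inj₂ y ∷ w) with x ≟ y
... | yes _ = 1 + occ x w
... | no  _ = occ x w

Quadratic : ∀ {n k} → WordEquation n k → Set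
Quadratic {k = k} E = (x : Fin k) → occ x (lhs E ++ rhs E) ≤ 2

AllVariablesOccur : ∀ {n k} → WordEquation n k → Set
AllVariablesOccur {k = k} E = (x : Fin k) → inj₂ x ∈ (lhs E ++ rhs E)

Len : ∀ {n k} → WordEquation n k → (Fin k → ℕ) → Set
Len {n} {k} E v =
  Σ (Assignment n k) λ σ → IsSolution E σ × ((i : Fin k) → length (σ i) ≡ v i)

-- Presburger arithmetic: first-order logic over (ℕ, +, ≤, =),
-- formulas with m free variables (de Bruijn indices in Fin m).

data Term (m : ℕ) : Set where
  var  : Fin m → Term m
  _⊕_  : Term m → Term m → Term m

data Formula : ℕ → Set where
  _≈ᶠ_ : ∀ {m} → Term m → Term m → Formula m
  _≤ᶠ_ : ∀ {m} → Term m → Term m → Formula m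
  ⊤ᶠ ⊥ᶠ : ∀ {m} → Formula m
  ¬ᶠ_  : ∀ {m} → Formula m → Formula m
  _∧ᶠ_ _∨ᶠ_ _⇒ᶠ_ : ∀ {m} → Formula m → Formula m → Formula m
  ∃ᶠ ∀ᶠ : ∀ {m} → Formula (sucℕ m) → Formula m

_▸_ : ∀ {m} → (Fin m → ℕ) → ℕ → (Fin (sucℕ m) → ℕ)
(ρ ▸ a) zero    = a
(ρ ▸ a) (suc i) = ρ i

⟦_⟧ₜ : ∀ {m} → Term m → (Fin m → ℕ) → ℕ
⟦ var i ⟧ₜ ρ = ρ i
⟦ s ⊕ t ⟧ₜ ρ = ⟦ s ⟧ₜ ρ + ⟦ t ⟧ₜ ρ

⟦_⟧ : ∀ {m} → Formula m → (Fin m → ℕ) → Set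
⟦ s ≈ᶠ t ⟧ ρ = ⟦ s ⟧ₜ ρ ≡ ⟦ t ⟧ₜ ρ
⟦ s ≤ᶠ t ⟧ ρ = ⟦ s ⟧ₜ ρ ≤ ⟦ t ⟧ₜ ρ
⟦ ⊤ᶠ ⟧ ρ = ⊤
⟦ ⊥ᶠ ⟧ ρ = ⊥
⟦ ¬ᶠ φ ⟧ ρ = ¬ ⟦ φ ⟧ ρ
⟦ φ ∧ᶠ ψ ⟧ ρ = ⟦ φ ⟧ ρ × ⟦ ψ ⟧ ρ
⟦ φ ∨ᶠ ψ ⟧ ρ = ⟦ φ ⟧ ρ ⊎ ⟦ ψ ⟧ ρ
⟦ φ ⇒ᶠ ψ ⟧ ρ = ⟦ φ ⟧ ρ → ⟦ ψ ⟧ ρ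
⟦ ∃ᶠ φ ⟧ ρ = Σ ℕ λ a → ⟦ φ ⟧ (ρ ▸ a)
⟦ ∀ᶠ φ ⟧ ρ = (a : ℕ) → ⟦ φ ⟧ (ρ ▸ a)

PresburgerDefinable : ∀ {k} → ((Fin k → ℕ) → Set) → Set
PresburgerDefinable {k} S =
  Σ (Formula k) λ φ → (v : Fin k → ℕ) → S v ⇔ ⟦ φ ⟧ v

-- In a solution of y a b x = x a b y the words a b x and a b y commute, so they are powers of
-- one word, of length at least 2; hence |x| + 2 and |y| + 2 have a common factor. On the other
-- hand (e, n (e + 2) + e) is always a length vector. If Len were Presburger-definable, so would be
-- the set of p for which some a < p has (a, p) ∈ Len. By quantifier elimination every
-- Presburger-definable subset of ℕ is eventually periodic, but this set omits p whenever p + 2 is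
-- prime and contains p + (p + 2) P for every P.

module Submission where

open import Defs
open import Data.Nat as ℕ using (ℕ; zero; suc; _!)
import Data.Nat.Properties as ℕ
open import Data.Nat.Divisibility as ℕ∣ using () renaming (_∣_ to _∣ℕ_)
open import Data.Nat.Induction using (<-wellFounded)
open import Data.Nat.ListAction using (product)
open import Data.Nat.ListAction.Properties using (∈⇒∣product; product≢0)
open import Data.Nat.Primality using (Prime; prime⇒nonZero; prime⇒nonTrivial; prime⇒irreducible)
open import Data.Nat.Primality.Factorisation using (factorise)
open import Data.Integer using (ℤ; +_; -[1+_]; _+_; _*_; -_; _-_; _≤_; _<_; 0ℤ; 1ℤ; -1ℤ; ∣_∣; +≤+; +<+)
import Data.Integer.Properties as ℤ
open import Data.Integer.Divisibility.Signed as ℤ∣ using (_∣_; divides; _∣?_)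
open import Data.Integer.Tactic.RingSolver using (solve-∀)
open import Data.Fin using (Fin; zero; suc)
open import Data.Vec as Vec using (Vec; []; _∷_)
open import Data.List as List using (List; []; _∷_; _++_; [_]; length; replicate)
import Data.List.Properties as List
open import Data.List.Relation.Unary.All as All using (All; []; _∷_)
import Data.List.Relation.Unary.All.Properties as All
open import Data.List.Relation.Unary.Any as Any using (Any; here; there)
import Data.List.Relation.Unary.Any.Properties as Any
open import Data.List.Membership.Propositional.Properties using (∈-map⁺)
open import Data.List.Extrema.Nat using (max; xs≤max)
open import Data.Maybe using (Maybe; just; nothing)
import Data.Maybe.Relation.Unary.Any as Maybe
open import Data.Product using (Σ; ∃; _×_; _,_)
open import Data.Product.Function.NonDependent.Propositional using (_×-⇔_)
import Data.Product.Function.Dependent.Propositional as Σ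
open import Data.Sum using (_⊎_; inj₁; inj₂; [_,_]′)
open import Data.Sum.Function.Propositional using (_⊎-⇔_)
open import Data.Empty using (⊥-elim)
open import Data.Unit using (tt)
open import Induction.WellFounded using (Acc; acc)
open import Relation.Nullary using (¬_; Dec; yes; no; ¬?)
open import Relation.Nullary.Decidable using (decidable-stable)
open import Relation.Nullary.Negation using (∀⟶¬∃¬)
open import Relation.Binary.PropositionalEquality using (_≡_; _≢_; refl; sym; trans; cong; cong₂; subst; subst₂; module ≡-Reasoning)
open import Function using (_∘_; id)
open import Function.Bundles using (_⇔_; mk⇔; Equivalence)
import Function.Properties.Equivalence as ⇔
open import Function.Related.Propositional using (module EquationalReasoning; ≡⇒; equivalence)
open import Function.Related.TypeIsomorphisms using (¬-cong-⇔; →-cong-⇔)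

open Equivalence using (to; from)

module _ {A : Set} where

  ¬⊎⇔→ : ∀ {B : Set} → Dec A → (¬ A ⊎ B) ⇔ (A → B)
  ¬⊎⇔→ (yes a) = mk⇔ [ (λ ¬a → ⊥-elim (¬a a)) , (λ b _ → b) ]′ (λ f → inj₂ (f a))
  ¬⊎⇔→ (no ¬a) = mk⇔ (λ _ a → ⊥-elim (¬a a)) (λ _ → inj₁ ¬a)

  ¬∃¬⇔∀ : ∀ {P : A → Set} → (∀ x → Dec (P x)) → (¬ ∃ λ x → ¬ P x) ⇔ (∀ x → P x)
  ¬∃¬⇔∀ P? = mk⇔ (λ ¬∃¬ x → decidable-stable (P? x) (λ ¬p → ¬∃¬ (x , ¬p))) ∀⟶¬∃¬

  Π-cong-⇔ : ∀ {P Q : A → Set} → (∀ x → P x ⇔ Q x) → (∀ x → P x) ⇔ (∀ x → Q x)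
  Π-cong-⇔ P⇔Q = mk⇔ (λ p x → to (P⇔Q x) (p x)) (λ q x → from (P⇔Q x) (q x))

module _ {A : Set} {P Q : A → Set} where

  All-cong-⇔ : ∀ {xs} → All (λ x → P x ⇔ Q x) xs → All P xs ⇔ All Q xs
  All-cong-⇔ P⇔Q = mk⇔ (λ ps → All.zipWith (λ (e , p) → to e p) (P⇔Q , ps))
                       (λ qs → All.zipWith (λ (e , q) → from e q) (P⇔Q , qs))

  Any-cong-⇔ : ∀ {xs} → All (λ x → P x ⇔ Q x) xs → Any P xs ⇔ Any Q xs
  Any-cong-⇔ []       = mk⇔ (λ ()) (λ ())
  Any-cong-⇔ (e ∷ es) = mk⇔
    (λ { (here p) → here (to e p)   ; (there p) → there (to (Any-cong-⇔ es) p) })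
    (λ { (here q) → here (from e q) ; (there q) → there (from (Any-cong-⇔ es) q) })

-- Combinatorics on words

module _ {A : Set} where

  infixr 8 _^_

  _^_ : List A → ℕ → List A
  w ^ zero  = []
  w ^ suc n = w ++ w ^ n

  ^-+ : ∀ w i j → w ^ (i ℕ.+ j) ≡ w ^ i ++ w ^ j
  ^-+ w zero    j = refl
  ^-+ w (suc i) j = trans (cong (w ++_) (^-+ w i j)) (sym (List.++-assoc w (w ^ i) (w ^ j)))

  ^-comm : ∀ w i → w ^ i ++ w ≡ w ++ w ^ i
  ^-comm w i = begin
    w ^ i ++ w          ≡⟨ cong (w ^ i ++_) (List.++-identityʳ w) ⟨
    w ^ i ++ w ^ 1      ≡⟨ ^-+ w i 1 ⟨
    w ^ (i ℕ.+ 1)       ≡⟨ cong (w ^_) (ℕ.+-comm i 1) ⟩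
    w ^ suc i           ∎
    where open ≡-Reasoning

  length-^ : ∀ w i → length (w ^ i) ≡ i ℕ.* length w
  length-^ w zero    = refl
  length-^ w (suc i) = trans (List.length-++ w) (cong (length w ℕ.+_) (length-^ w i))

  []^ : ∀ i → [] ^ i ≡ []
  []^ zero    = refl
  []^ (suc i) = []^ i

  ++-split : ∀ (u v r s : List A) → u ++ r ≡ v ++ s →
             (∃ λ t → v ≡ u ++ t × r ≡ t ++ s) ⊎ (∃ λ t → u ≡ v ++ t × s ≡ t ++ r)
  ++-split []      v       r s eq = inj₁ (v , refl , eq)
  ++-split (c ∷ u) []      r s eq = inj₂ (c ∷ u , refl , sym eq)
  ++-split (c ∷ u) (d ∷ v) r s eq with List.∷-injective eq
  ... | refl , eq′ with ++-split u v r s eq′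
  ... | inj₁ (t , v≡ut , r≡ts) = inj₁ (t , cong (c ∷_) v≡ut , r≡ts)
  ... | inj₂ (t , u≡vt , s≡tr) = inj₂ (t , cong (c ∷_) u≡vt , s≡tr)

  CommonRoot : List A → List A → Set
  CommonRoot u v = ∃ λ z → ∃ λ i → ∃ λ j → u ≡ z ^ i × v ≡ z ^ j

  commute⇒commonRoot : ∀ u v → u ++ v ≡ v ++ u → CommonRoot u v
  commute⇒commonRoot u v = go u v (<-wellFounded _)
    where
    extend : ∀ {u t v} → v ≡ u ++ t → CommonRoot u t → CommonRoot u v
    extend v≡ut (z , i , j , u≡zⁱ , t≡zʲ) =
      z , i , i ℕ.+ j , u≡zⁱ , trans v≡ut (trans (cong₂ _++_ u≡zⁱ t≡zʲ) (sym (^-+ z i j)))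

    swap : ∀ {u v} → CommonRoot u v → CommonRoot v u
    swap (z , i , j , u≡zⁱ , v≡zʲ) = z , j , i , v≡zʲ , u≡zⁱ

    shorter : ∀ {u t v : List A} → 0 ℕ.< length u → v ≡ u ++ t →
              length u ℕ.+ length t ℕ.< length u ℕ.+ length v
    shorter {u} {t} 0<∣u∣ refl rewrite List.length-++ u {t} =
      ℕ.+-monoʳ-< (length u) (ℕ.m<n+m (length t) 0<∣u∣)

    go : ∀ u v → Acc ℕ._<_ (length u ℕ.+ length v) → u ++ v ≡ v ++ u → CommonRoot u v
    go []        v         _         _     = v , 0 , 1 , refl , sym (List.++-identityʳ v)
    go u@(_ ∷ _) []        _         _     = u , 1 , 0 , sym (List.++-identityʳ u) , refl
    go u@(_ ∷ _) v@(_ ∷ _) (acc rec) uv≡vu with ++-split u v v u uv≡vu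
    ... | inj₁ (t , v≡ut , v≡tu) =
      extend v≡ut (go u t (rec (shorter {u} {t} ℕ.z<s v≡ut)) (trans (sym v≡ut) v≡tu))
    ... | inj₂ (t , u≡vt , u≡tv) =
      swap (extend u≡vt (go v t (rec (subst (length v ℕ.+ length t ℕ.<_) (ℕ.+-comm (length v) (length u))
                                            (shorter {v} {t} ℕ.z<s u≡vt)))
                                (trans (sym u≡vt) u≡tv)))

  root-length≥2 : ∀ {a b : A} w z i → a ≢ b → a ∷ b ∷ w ≡ z ^ i → 2 ℕ.≤ length z
  root-length≥2 w []          i             a≢b eq with trans eq ([]^ i)
  ... | ()
  root-length≥2 w (c ∷ [])    zero          a≢b ()
  root-length≥2 w (c ∷ [])    (suc zero)    a≢b ()
  root-length≥2 w (c ∷ [])    (suc (suc i)) a≢b refl = ⊥-elim (a≢b refl)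
  root-length≥2 w (c ∷ d ∷ z) i             a≢b eq = ℕ.s≤s (ℕ.s≤s ℕ.z≤n)

n∣n! : ∀ n → .{{ℕ.NonZero n}} → n ∣ℕ n !
n∣n! (suc n) = ℕ∣.m∣m*n (n !)

-- Euclid: every prime factor of K! + 1 exceeds K.
prime> : ∀ K → ∃ λ p → K ℕ.< p × Prime p
prime> K with factorise (suc (K !))
... | record { factors = [] ; isFactorisation = K!+1≡1 } =
  ⊥-elim (ℕ.<⇒≱ (ℕ.1≤n! K) (ℕ.≤-reflexive (ℕ.suc-injective K!+1≡1)))
... | record { factors = p ∷ ps ; isFactorisation = K!+1≡p*ps ; factorsPrime = p-prime ∷ _ } =
  p , ℕ.≰⇒> p≰K , p-prime
  where
  p∣K!+1 : p ∣ℕ K ! ℕ.+ 1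
  p∣K!+1 = subst (p ∣ℕ_) (trans (sym K!+1≡p*ps) (ℕ.+-comm 1 (K !))) (ℕ∣.m∣m*n (product ps))
  p≰K : ¬ p ℕ.≤ K
  p≰K p≤K = ℕ.<⇒≢ (ℕ.nonTrivial⇒n>1 p {{prime⇒nonTrivial p-prime}})
                  (sym (ℕ∣.∣1⇒≡1 (ℕ∣.∣m+n∣m⇒∣n p∣K!+1 p∣K!)))
    where
    p∣K! : p ∣ℕ K !
    p∣K! = ℕ∣.∣-trans (n∣n! p {{prime⇒nonZero p-prime}}) (ℕ∣.m≤n⇒m!∣n! p≤K)

-- Linear arithmetic over ℤ

private
  variable
    m : ℕ

Valuation : ℕ → Set
Valuation m = Fin m → ℕ

record LinearForm (m : ℕ) : Set where
  constructor linear
  field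
    coeffs : Vec ℤ m
    const  : ℤ

dot : Vec ℤ m → Valuation m → ℤ
dot []       ρ = 0ℤ
dot (c ∷ cs) ρ = c * + ρ zero + dot cs (ρ ∘ suc)

⟦_⟧ˡ : LinearForm m → Valuation m → ℤ
⟦ linear cs k ⟧ˡ ρ = dot cs ρ + k

infixl 6 _+ˡ_ _-ˡ_
infixl 7 _*ˡ_

_+ˡ_ : LinearForm m → LinearForm m → LinearForm m
linear a k +ˡ linear b l = linear (Vec.zipWith _+_ a b) (k + l)

_*ˡ_ : ℤ → LinearForm m → LinearForm m
s *ˡ linear a k = linear (Vec.map (s *_) a) (s * k)

_-ˡ_ : LinearForm m → LinearForm m → LinearForm m
t -ˡ u = t +ˡ -1ℤ *ˡ u

constˡ : ℤ → LinearForm m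
constˡ c = linear (Vec.replicate _ 0ℤ) c

varˡ : Fin m → LinearForm m
varˡ i = linear (Vec.replicate _ 0ℤ Vec.[ i ]≔ 1ℤ) 0ℤ

dot-zeros : ∀ m (ρ : Valuation m) → dot (Vec.replicate m 0ℤ) ρ ≡ 0ℤ
dot-zeros zero    ρ = refl
dot-zeros (suc m) ρ = cong (λ v → 0ℤ * + ρ zero + v) (dot-zeros m (ρ ∘ suc))

dot-zipWith : ∀ (a b : Vec ℤ m) ρ → dot (Vec.zipWith _+_ a b) ρ ≡ dot a ρ + dot b ρ
dot-zipWith []       []       ρ = refl
dot-zipWith (a ∷ as) (b ∷ bs) ρ
  rewrite dot-zipWith as bs (ρ ∘ suc) = lemma a b (+ ρ zero) (dot as (ρ ∘ suc)) (dot bs (ρ ∘ suc))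
  where
  lemma : ∀ a b x u v → (a + b) * x + (u + v) ≡ (a * x + u) + (b * x + v)
  lemma = solve-∀

dot-map : ∀ s (a : Vec ℤ m) ρ → dot (Vec.map (s *_) a) ρ ≡ s * dot a ρ
dot-map s []       ρ = sym (ℤ.*-zeroʳ s)
dot-map s (a ∷ as) ρ rewrite dot-map s as (ρ ∘ suc) = lemma s a (+ ρ zero) (dot as (ρ ∘ suc))
  where
  lemma : ∀ s a x u → s * a * x + s * u ≡ s * (a * x + u)
  lemma = solve-∀

dot-unit : ∀ {m} (i : Fin m) ρ → dot (Vec.replicate m 0ℤ Vec.[ i ]≔ 1ℤ) ρ ≡ + ρ i
dot-unit {suc m} zero ρ rewrite dot-zeros m (ρ ∘ suc) = trans (ℤ.+-identityʳ _) (ℤ.*-identityˡ _)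
dot-unit {suc m} (suc i) ρ rewrite dot-unit i (ρ ∘ suc) = ℤ.+-identityˡ (+ ρ (suc i))

⟦+ˡ⟧ : ∀ (t u : LinearForm m) ρ → ⟦ t +ˡ u ⟧ˡ ρ ≡ ⟦ t ⟧ˡ ρ + ⟦ u ⟧ˡ ρ
⟦+ˡ⟧ (linear a k) (linear b l) ρ rewrite dot-zipWith a b ρ = lemma (dot a ρ) (dot b ρ) k l
  where
  lemma : ∀ x y k l → x + y + (k + l) ≡ x + k + (y + l)
  lemma = solve-∀

⟦*ˡ⟧ : ∀ s (t : LinearForm m) ρ → ⟦ s *ˡ t ⟧ˡ ρ ≡ s * ⟦ t ⟧ˡ ρ
⟦*ˡ⟧ s (linear a k) ρ rewrite dot-map s a ρ = sym (ℤ.*-distribˡ-+ s (dot a ρ) k)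

⟦-ˡ⟧ : ∀ (t u : LinearForm m) ρ → ⟦ t -ˡ u ⟧ˡ ρ ≡ ⟦ t ⟧ˡ ρ - ⟦ u ⟧ˡ ρ
⟦-ˡ⟧ t u ρ rewrite ⟦+ˡ⟧ t (-1ℤ *ˡ u) ρ | ⟦*ˡ⟧ -1ℤ u ρ = cong (_+_ (⟦ t ⟧ˡ ρ)) (ℤ.-1*i≡-i (⟦ u ⟧ˡ ρ))

⟦constˡ⟧ : ∀ c (ρ : Valuation m) → ⟦ constˡ c ⟧ˡ ρ ≡ c
⟦constˡ⟧ {m} c ρ rewrite dot-zeros m ρ = ℤ.+-identityˡ c

⟦varˡ⟧ : ∀ (i : Fin m) ρ → ⟦ varˡ i ⟧ˡ ρ ≡ + ρ i
⟦varˡ⟧ i ρ rewrite dot-unit i ρ = ℤ.+-identityʳ (+ ρ i)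

⟦⟧ˡ-▸ : ∀ c cs k (ρ : Valuation m) x → ⟦ linear (c ∷ cs) k ⟧ˡ (ρ ▸ x) ≡ c * + x + ⟦ linear cs k ⟧ˡ ρ
⟦⟧ˡ-▸ c cs k ρ x = ℤ.+-assoc (c * + x) (dot cs ρ) k

data Constraint : Set where
  nonNeg   : Constraint
  dvd ndvd : ℕ → Constraint

-- dvd d and ndvd d test divisibility by suc d.
Holds : Constraint → ℤ → Set
Holds nonNeg   v = 0ℤ ≤ v
Holds (dvd d)  v = + suc d ∣ v
Holds (ndvd d) v = ¬ (+ suc d ∣ v)

holds? : ∀ κ v → Dec (Holds κ v)
holds? nonNeg   v = 0ℤ ℤ.≤? v
holds? (dvd d)  v = + suc d ∣? v
holds? (ndvd d) v = ¬? (+ suc d ∣? v)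

modulus : Constraint → ℕ
modulus nonNeg   = 1
modulus (dvd d)  = suc d
modulus (ndvd d) = suc d

record Literal (m : ℕ) : Set where
  constructor lit
  field
    constraint : Constraint
    form       : LinearForm m
open Literal

infix 4 _⊨_ _⊨ᶜ_ _⊨ᴰ_

_⊨_ : Valuation m → Literal m → Set
ρ ⊨ lit κ t = Holds κ (⟦ t ⟧ˡ ρ)

Conjunction DNF : ℕ → Set
Conjunction m = List (Literal m)
DNF m = List (Conjunction m)

_⊨ᶜ_ : Valuation m → Conjunction m → Set
ρ ⊨ᶜ C = All (ρ ⊨_) C

_⊨ᴰ_ : Valuation m → DNF m → Set
ρ ⊨ᴰ D = Any (ρ ⊨ᶜ_) D

⊨? : ∀ (ρ : Valuation m) ℓ → Dec (ρ ⊨ ℓ)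
⊨? ρ (lit κ t) = holds? κ (⟦ t ⟧ˡ ρ)

⊨ᴰ? : ∀ (ρ : Valuation m) D → Dec (ρ ⊨ᴰ D)
⊨ᴰ? ρ = Any.any? (All.all? (⊨? ρ))

negate : Literal m → Literal m
negate (lit nonNeg t)   = lit nonNeg (-1ℤ *ˡ t +ˡ constˡ -1ℤ)
negate (lit (dvd d) t)  = lit (ndvd d) t
negate (lit (ndvd d) t) = lit (dvd d) t

0≤-1-v⇔v<0 : ∀ v → (0ℤ ≤ -1ℤ * v + -1ℤ) ⇔ (¬ 0ℤ ≤ v)
0≤-1-v⇔v<0 (+ zero)  = mk⇔ (λ ()) (λ 0≰0 → ⊥-elim (0≰0 (+≤+ ℕ.z≤n)))
0≤-1-v⇔v<0 (+ suc n) = mk⇔ (λ ()) (λ 0≰n → ⊥-elim (0≰n (+≤+ ℕ.z≤n)))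
0≤-1-v⇔v<0 -[1+ n ]  = mk⇔ (λ _ ()) (λ _ → +≤+ ℕ.z≤n)

negate-correct : ∀ (ℓ : Literal m) ρ → (ρ ⊨ negate ℓ) ⇔ (¬ ρ ⊨ ℓ)
negate-correct (lit nonNeg t) ρ
  rewrite ⟦+ˡ⟧ (-1ℤ *ˡ t) (constˡ -1ℤ) ρ | ⟦*ˡ⟧ -1ℤ t ρ | ⟦constˡ⟧ -1ℤ ρ = 0≤-1-v⇔v<0 (⟦ t ⟧ˡ ρ)
negate-correct (lit (dvd d) t)  ρ = mk⇔ id id
negate-correct (lit (ndvd d) t) ρ = mk⇔ (λ d∣v d∤v → d∤v d∣v) (decidable-stable (+ suc d ∣? ⟦ t ⟧ˡ ρ))

infixr 6 _∧ᴰ_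

_∧ᴰ_ : DNF m → DNF m → DNF m
_∧ᴰ_ = List.cartesianProductWith _++_

∧ᴰ-correct : ∀ (D E : DNF m) ρ → (ρ ⊨ᴰ D ∧ᴰ E) ⇔ (ρ ⊨ᴰ D × ρ ⊨ᴰ E)
∧ᴰ-correct D E ρ = mk⇔
  (Any.cartesianProductWith⁻ _++_ (λ {C} → All.++⁻ C) D E)
  (λ (p , q) → Any.cartesianProductWith⁺ _++_ All.++⁺ p q)

∨ᴰ-correct : ∀ (D E : DNF m) ρ → (ρ ⊨ᴰ D ++ E) ⇔ (ρ ⊨ᴰ D ⊎ ρ ⊨ᴰ E)
∨ᴰ-correct D E ρ = mk⇔ (Any.++⁻ D) [ Any.++⁺ˡ , Any.++⁺ʳ D ]′

¬ᶜ : Conjunction m → DNF m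
¬ᶜ = List.map ([_] ∘ negate)

¬ᶜ-correct : ∀ (C : Conjunction m) ρ → (ρ ⊨ᴰ ¬ᶜ C) ⇔ (¬ ρ ⊨ᶜ C)
¬ᶜ-correct C ρ = mk⇔
  (All.Any¬⇒¬All ∘ Any.map (λ { {ℓ} (h ∷ []) → to (negate-correct ℓ ρ) h }) ∘ Any.map⁻)
  (Any.map⁺ ∘ Any.map (λ {ℓ} h → from (negate-correct ℓ ρ) h ∷ []) ∘ All.¬All⇒Any¬ (⊨? ρ) C)

¬ᴰ : DNF m → DNF m
¬ᴰ = List.foldr (λ C N → ¬ᶜ C ∧ᴰ N) [ [] ]

¬ᴰ-correct : ∀ (D : DNF m) ρ → (ρ ⊨ᴰ ¬ᴰ D) ⇔ (¬ ρ ⊨ᴰ D)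
¬ᴰ-correct []      ρ = mk⇔ (λ _ ()) (λ _ → here [])
¬ᴰ-correct (C ∷ D) ρ = mk⇔
  (λ h → let ¬C , ¬D = to (∧ᴰ-correct (¬ᶜ C) (¬ᴰ D) ρ) h
         in λ { (here c) → to (¬ᶜ-correct C ρ) ¬C c ; (there d) → to (¬ᴰ-correct D ρ) ¬D d })
  (λ ¬CD → from (∧ᴰ-correct (¬ᶜ C) (¬ᴰ D) ρ)
    (from (¬ᶜ-correct C ρ) (¬CD ∘ here) , from (¬ᴰ-correct D ρ) (¬CD ∘ there)))

-- Quantifier elimination for Presburger arithmetic

infix 4 _⨾_⊨_

_⨾_⊨_ : ℤ → Valuation m → Literal (suc m) → Set
q ⨾ ρ ⊨ lit κ (linear (c ∷ cs) k) = Holds κ (c * q + ⟦ linear cs k ⟧ˡ ρ)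

▸⊨⇔⨾⊨ : ∀ (ℓ : Literal (suc m)) ρ x → (ρ ▸ x ⊨ ℓ) ⇔ (+ x ⨾ ρ ⊨ ℓ)
▸⊨⇔⨾⊨ (lit κ (linear (c ∷ cs) k)) ρ x = ≡⇒ {k = equivalence} (cong (Holds κ) (⟦⟧ˡ-▸ c cs k ρ x))

x≥0 : Literal (suc m)
x≥0 = lit nonNeg (linear (1ℤ ∷ Vec.replicate _ 0ℤ) 0ℤ)

x≥0-correct : ∀ q (ρ : Valuation m) → (q ⨾ ρ ⊨ x≥0) ⇔ (0ℤ ≤ q)
x≥0-correct {m} q ρ rewrite dot-zeros m ρ | ℤ.*-identityˡ q = ≡⇒ {k = equivalence} (cong (0ℤ ≤_) (ℤ.+-identityʳ q))

lowerBound : Literal (suc m) → Maybe (ℕ × LinearForm m)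
lowerBound (lit nonNeg (linear (+ suc c ∷ cs) k)) = just (c , linear cs k)
lowerBound _                                     = nothing

shift-down : ∀ h q r P → h * (q - P) + r ≡ (h * q + r) + (- h) * P
shift-down = solve-∀

nonNeg-step : ∀ h a q r P → - h ≡ + a → 0ℤ ≤ h * q + r → 0ℤ ≤ h * (q - + P) + r
nonNeg-step h a q r P -h≡a 0≤v rewrite shift-down h q r (+ P) | -h≡a | sym (ℤ.pos-* a P) =
  ℤ.+-mono-≤ 0≤v (+≤+ ℕ.z≤n)

NearBound : ℕ → ℤ → Valuation m → ℕ × LinearForm m → Set
NearBound P q ρ (c , t) = ∃ λ k → k ℕ.< suc c ℕ.* P × + suc c * q + ⟦ t ⟧ˡ ρ ≡ + k

step-down : ∀ (ℓ : Literal (suc m)) P q ρ → modulus (constraint ℓ) ∣ℕ P → q ⨾ ρ ⊨ ℓ →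
            (q - + P ⨾ ρ ⊨ ℓ) ⊎ Maybe.Any (NearBound P q ρ) (lowerBound ℓ)
step-down (lit nonNeg (linear (+ suc c ∷ cs) k)) P q ρ _ 0≤v
  with 0ℤ ℤ.≤? + suc c * (q - + P) + ⟦ linear cs k ⟧ˡ ρ
... | yes 0≤w = inj₁ 0≤w
... | no  0≰w = inj₂ (Maybe.just (∣ v ∣ , ℤ.drop‿+<+ ∣v∣<SP , sym (ℤ.0≤i⇒+∣i∣≡i 0≤v)))
  where
  r v w : ℤ
  r = ⟦ linear cs k ⟧ˡ ρ
  v = + suc c * q + r
  w = + suc c * (q - + P) + r
  w+SP≡v : w + + suc c * + P ≡ v
  w+SP≡v = lemma (+ suc c) q r (+ P)
    where
    lemma : ∀ S q r P → S * (q - P) + r + S * P ≡ S * q + r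
    lemma = solve-∀
  ∣v∣<SP : + ∣ v ∣ < + (suc c ℕ.* P)
  ∣v∣<SP = subst₂ _<_ (trans w+SP≡v (sym (ℤ.0≤i⇒+∣i∣≡i 0≤v)))
                      (trans (ℤ.+-identityˡ _) (sym (ℤ.pos-* (suc c) P)))
                      (ℤ.+-monoˡ-< (+ suc c * + P) (ℤ.≰⇒> 0≰w))
step-down (lit nonNeg (linear (+ zero ∷ cs) k))   P q ρ _ 0≤v =
  inj₁ (nonNeg-step (+ zero) 0 q (⟦ linear cs k ⟧ˡ ρ) P refl 0≤v)
step-down (lit nonNeg (linear (-[1+ n ] ∷ cs) k)) P q ρ _ 0≤v =
  inj₁ (nonNeg-step -[1+ n ] (suc n) q (⟦ linear cs k ⟧ˡ ρ) P refl 0≤v)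
step-down (lit (dvd d) (linear (h ∷ cs) k)) P q ρ d∣P d∣v
  rewrite shift-down h q (⟦ linear cs k ⟧ˡ ρ) (+ P) =
  inj₁ (ℤ∣.∣m∣n⇒∣m+n d∣v (ℤ∣.∣n⇒∣m*n (- h) (ℤ∣.∣ᵤ⇒∣ d∣P)))
step-down (lit (ndvd d) (linear (h ∷ cs) k)) P q ρ d∣P d∤v
  rewrite shift-down h q (⟦ linear cs k ⟧ˡ ρ) (+ P) =
  inj₁ (λ d∣w → d∤v (ℤ∣.∣m+n∣n⇒∣m d∣w (ℤ∣.∣n⇒∣m*n (- h) (ℤ∣.∣ᵤ⇒∣ d∣P))))

all-step-down : ∀ (C : Conjunction (suc m)) P q ρ → All (λ ℓ → modulus (constraint ℓ) ∣ℕ P) C →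
                All (q ⨾ ρ ⊨_) C →
                All (q - + P ⨾ ρ ⊨_) C ⊎ Any (Maybe.Any (NearBound P q ρ) ∘ lowerBound) C
all-step-down []      P q ρ []         []       = inj₁ []
all-step-down (ℓ ∷ C) P q ρ (ℓ∣P ∷ C∣P) (h ∷ hs)
  with step-down ℓ P q ρ ℓ∣P h | all-step-down C P q ρ C∣P hs
... | inj₂ near | _         = inj₂ (here near)
... | inj₁ _    | inj₂ near = inj₂ (there near)
... | inj₁ h′   | inj₁ hs′  = inj₁ (h′ ∷ hs′)

period : Conjunction m → ℕ
period C = product (List.map (modulus ∘ constraint) C)

modulus∣period : ∀ (C : Conjunction m) → All (λ ℓ → modulus (constraint ℓ) ∣ℕ period C) C
modulus∣period C = All.tabulate (λ ℓ∈C → ∈⇒∣product (∈-map⁺ (modulus ∘ constraint) ℓ∈C))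

period≢0 : ∀ (C : Conjunction m) → ℕ.NonZero (period C)
period≢0 C = product≢0 (All.map⁺ (All.universal (modulus≢0 ∘ constraint) C))
  where
  modulus≢0 : ∀ κ → ℕ.NonZero (modulus κ)
  modulus≢0 nonNeg   = _
  modulus≢0 (dvd d)  = _
  modulus≢0 (ndvd d) = _

scale : ℕ → Constraint → Constraint
scale c nonNeg   = nonNeg
scale c (dvd d)  = dvd (d ℕ.+ c ℕ.* suc d)
scale c (ndvd d) = ndvd (d ℕ.+ c ℕ.* suc d)

scale-correct : ∀ c κ v → Holds (scale c κ) (+ suc c * v) ⇔ Holds κ v
scale-correct c nonNeg v = mk⇔
  (λ 0≤cv → ℤ.*-cancelˡ-≤-pos 0ℤ v (+ suc c) (subst (_≤ + suc c * v) (sym (ℤ.*-zeroʳ (+ suc c))) 0≤cv))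
  (λ 0≤v → subst (_≤ + suc c * v) (ℤ.*-zeroʳ (+ suc c)) (ℤ.*-monoˡ-≤-nonNeg (+ suc c) 0≤v))
scale-correct c (dvd d) v rewrite ℤ.pos-* (suc c) (suc d) =
  mk⇔ (ℤ∣.*-cancelˡ-∣ (+ suc c)) (ℤ∣.*-monoʳ-∣ (+ suc c))
scale-correct c (ndvd d) v rewrite ℤ.pos-* (suc c) (suc d) =
  mk⇔ (λ ∤cv ∣v → ∤cv (ℤ∣.*-monoʳ-∣ (+ suc c) ∣v)) (λ ∤v ∣cv → ∤v (ℤ∣.*-cancelˡ-∣ (+ suc c) ∣cv))

-- Replaces suc c · x by e, after multiplying the literal by suc c.
substitute : ℕ → LinearForm m → Literal (suc m) → Literal m
substitute c e (lit κ (linear (h ∷ cs) k)) = lit (scale c κ) (h *ˡ e +ˡ + suc c *ˡ linear cs k)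

substitute-correct : ∀ c e (ℓ : Literal (suc m)) q ρ → + suc c * q ≡ ⟦ e ⟧ˡ ρ →
                     (ρ ⊨ substitute c e ℓ) ⇔ (q ⨾ ρ ⊨ ℓ)
substitute-correct c e (lit κ (linear (h ∷ cs) k)) q ρ Sq≡e =
  subst (λ v → Holds (scale c κ) v ⇔ Holds κ (h * q + r)) (sym value) (scale-correct c κ (h * q + r))
  where
  open ≡-Reasoning
  r : ℤ
  r = ⟦ linear cs k ⟧ˡ ρ
  value : ⟦ h *ˡ e +ˡ + suc c *ˡ linear cs k ⟧ˡ ρ ≡ + suc c * (h * q + r)
  value = begin
    ⟦ h *ˡ e +ˡ + suc c *ˡ linear cs k ⟧ˡ ρ ≡⟨ ⟦+ˡ⟧ (h *ˡ e) (+ suc c *ˡ linear cs k) ρ ⟩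
    ⟦ h *ˡ e ⟧ˡ ρ + ⟦ + suc c *ˡ linear cs k ⟧ˡ ρ ≡⟨ cong₂ _+_ (⟦*ˡ⟧ h e ρ) (⟦*ˡ⟧ (+ suc c) (linear cs k) ρ) ⟩
    h * ⟦ e ⟧ˡ ρ + + suc c * r              ≡⟨ cong (λ v → h * v + + suc c * r) (sym Sq≡e) ⟩
    h * (+ suc c * q) + + suc c * r         ≡⟨ lemma h (+ suc c) q r ⟩
    + suc c * (h * q + r)                   ∎
    where
    lemma : ∀ h S q r → h * (S * q) + S * r ≡ S * (h * q + r)
    lemma = solve-∀

pin : Conjunction (suc m) → ℕ → LinearForm m → ℕ → Conjunction m
pin C c t k = lit (dvd c) (constˡ (+ k) -ˡ t) ∷ List.map (substitute c (constˡ (+ k) -ˡ t)) C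

pin-complete : ∀ (C : Conjunction (suc m)) c t k q ρ → + suc c * q + ⟦ t ⟧ˡ ρ ≡ + k →
               All (q ⨾ ρ ⊨_) C → ρ ⊨ᶜ pin C c t k
pin-complete C c t k q ρ Sq+t≡k hs =
  divides q (trans (sym Sq≡e) (ℤ.*-comm (+ suc c) q)) ∷
  All.map⁺ (All.map (λ {ℓ} → from (substitute-correct c e ℓ q ρ Sq≡e)) hs)
  where
  e : LinearForm _
  e = constˡ (+ k) -ˡ t
  Sq≡e : + suc c * q ≡ ⟦ e ⟧ˡ ρ
  Sq≡e = begin
    + suc c * q                             ≡⟨ lemma (+ suc c * q) (⟦ t ⟧ˡ ρ) ⟩
    + suc c * q + ⟦ t ⟧ˡ ρ - ⟦ t ⟧ˡ ρ       ≡⟨ cong (_- ⟦ t ⟧ˡ ρ) Sq+t≡k ⟩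
    + k - ⟦ t ⟧ˡ ρ                          ≡⟨ cong (_- ⟦ t ⟧ˡ ρ) (⟦constˡ⟧ (+ k) ρ) ⟨
    ⟦ constˡ (+ k) ⟧ˡ ρ - ⟦ t ⟧ˡ ρ          ≡⟨ ⟦-ˡ⟧ (constˡ (+ k)) t ρ ⟨
    ⟦ e ⟧ˡ ρ                                ∎
    where
    open ≡-Reasoning
    lemma : ∀ a b → a ≡ a + b - b
    lemma = solve-∀

pin-sound : ∀ (C : Conjunction (suc m)) c t k ρ → ρ ⊨ᶜ pin C c t k → ∃ λ q → All (q ⨾ ρ ⊨_) C
pin-sound C c t k ρ (divides q e≡qS ∷ hs) =
  q , All.map (λ {ℓ} → to (substitute-correct c e ℓ q ρ Sq≡e)) (All.map⁻ hs)
  where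
  e : LinearForm _
  e = constˡ (+ k) -ˡ t
  Sq≡e : + suc c * q ≡ ⟦ e ⟧ˡ ρ
  Sq≡e = trans (ℤ.*-comm (+ suc c) q) (sym e≡qS)

candidates : Conjunction (suc m) → ℕ × LinearForm m → DNF m
candidates C (c , t) = List.applyUpTo (pin C c t) (suc c ℕ.* period C)

near⇒candidates : ∀ (C : Conjunction (suc m)) q ρ b → All (q ⨾ ρ ⊨_) C →
                  NearBound (period C) q ρ b → ρ ⊨ᴰ candidates C b
near⇒candidates C q ρ (c , t) hs (k , k<SP , Sq+t≡k) =
  Any.applyUpTo⁺ (pin C c t) (pin-complete C c t k q ρ Sq+t≡k hs) k<SP

-- Descending from a solution in steps of the period P keeps a solution until some lower bound
-- (suc c) x + t ≥ 0 is about to fail, that is (suc c) x + t = k < (suc c) P; pin then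
-- eliminates x through (suc c) x = k - t. The literal x ≥ 0 guarantees that a lower bound exists.
eliminate : Conjunction (suc m) → DNF m
eliminate C = List.concatMap (candidates (x≥0 ∷ C)) (List.mapMaybe lowerBound (x≥0 ∷ C))

eliminate-sound : ∀ (C : Conjunction (suc m)) ρ → ρ ⊨ᴰ eliminate C → ∃ λ x → ρ ▸ x ⊨ᶜ C
eliminate-sound C ρ h
  with Any.satisfied (Any.concatMap⁻ (candidates (x≥0 ∷ C)) {xs = List.mapMaybe lowerBound (x≥0 ∷ C)} h)
... | (c , t) , pinned with Any.applyUpTo⁻ (pin (x≥0 ∷ C) c t) pinned
... | k , _ , p with pin-sound (x≥0 ∷ C) c t k ρ p
... | q , q≥0 ∷ hs = ∣ q ∣ , All.map (λ {ℓ} → from (▸⊨⇔⨾⊨ ℓ ρ ∣ q ∣) ∘ subst (_⨾ ρ ⊨ ℓ) (sym ∣q∣≡q)) hs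
  where
  ∣q∣≡q : + ∣ q ∣ ≡ q
  ∣q∣≡q = ℤ.0≤i⇒+∣i∣≡i (to (x≥0-correct q ρ) q≥0)

eliminate-complete : ∀ (C : Conjunction (suc m)) ρ x → ρ ▸ x ⊨ᶜ C → ρ ⊨ᴰ eliminate C
eliminate-complete C ρ x h =
  descend x (<-wellFounded x) (from (x≥0-correct (+ x) ρ) (+≤+ ℕ.z≤n) ∷ All.map (λ {ℓ} → to (▸⊨⇔⨾⊨ ℓ ρ x)) h)
  where
  C⁺ : Conjunction _
  C⁺ = x≥0 ∷ C
  P : ℕ
  P = period C⁺
  descend : ∀ y → Acc ℕ._<_ y → All (+ y ⨾ ρ ⊨_) C⁺ → ρ ⊨ᴰ eliminate C
  descend y (acc rec) hs with all-step-down C⁺ P (+ y) ρ (modulus∣period C⁺) hs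
  ... | inj₂ near = Any.concatMap⁺ (candidates C⁺)
          (Any.map (λ {b} → near⇒candidates C⁺ (+ y) ρ b hs) (Any.mapMaybe⁺ lowerBound C⁺ (Any.map⁺ near)))
  ... | inj₁ hs′@(y-P≥0 ∷ _) =
    descend (y ℕ.∸ P) (rec y∸P<y) (subst (λ q → All (q ⨾ ρ ⊨_) C⁺) y-P≡y∸P hs′)
    where
    P≤y : P ℕ.≤ y
    P≤y = ℤ.drop‿+≤+ (ℤ.0≤i-j⇒j≤i (to (x≥0-correct (+ y - + P) ρ) y-P≥0))
    y-P≡y∸P : + y - + P ≡ + (y ℕ.∸ P)
    y-P≡y∸P = trans (ℤ.m-n≡m⊖n y P) (ℤ.⊖-≥ P≤y)
    y∸P<y : y ℕ.∸ P ℕ.< y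
    y∸P<y = ℕ.∸-monoʳ-< (ℕ.>-nonZero⁻¹ P {{period≢0 C⁺}}) P≤y

eliminateᴰ : DNF (suc m) → DNF m
eliminateᴰ = List.concatMap eliminate

eliminateᴰ-correct : ∀ (D : DNF (suc m)) ρ → (ρ ⊨ᴰ eliminateᴰ D) ⇔ (∃ λ x → ρ ▸ x ⊨ᴰ D)
eliminateᴰ-correct D ρ = mk⇔
  (Any.Any-Σ⁻ʳ ∘ Any.map (λ {C} → eliminate-sound C ρ) ∘ Any.concatMap⁻ eliminate)
  (λ (x , h) → Any.concatMap⁺ eliminate (Any.map (λ {C} → eliminate-complete C ρ x) h))

termForm : Term m → LinearForm m
termForm (var i) = varˡ i
termForm (s ⊕ t) = termForm s +ˡ termForm t

⟦termForm⟧ : ∀ (t : Term m) ρ → ⟦ termForm t ⟧ˡ ρ ≡ + ⟦ t ⟧ₜ ρ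
⟦termForm⟧ (var i) ρ = ⟦varˡ⟧ i ρ
⟦termForm⟧ (s ⊕ t) ρ = begin
  ⟦ termForm s +ˡ termForm t ⟧ˡ ρ             ≡⟨ ⟦+ˡ⟧ (termForm s) (termForm t) ρ ⟩
  ⟦ termForm s ⟧ˡ ρ + ⟦ termForm t ⟧ˡ ρ       ≡⟨ cong₂ _+_ (⟦termForm⟧ s ρ) (⟦termForm⟧ t ρ) ⟩
  + ⟦ s ⟧ₜ ρ + + ⟦ t ⟧ₜ ρ                     ≡⟨ ℤ.pos-+ (⟦ s ⟧ₜ ρ) (⟦ t ⟧ₜ ρ) ⟨
  + (⟦ s ⟧ₜ ρ ℕ.+ ⟦ t ⟧ₜ ρ)                   ∎
  where open ≡-Reasoning

_≤ᴸ_ : Term m → Term m → Literal m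
s ≤ᴸ t = lit nonNeg (termForm t -ˡ termForm s)

≤ᴸ-correct : ∀ (s t : Term m) ρ → (ρ ⊨ s ≤ᴸ t) ⇔ (⟦ s ⟧ₜ ρ ℕ.≤ ⟦ t ⟧ₜ ρ)
≤ᴸ-correct s t ρ rewrite ⟦-ˡ⟧ (termForm t) (termForm s) ρ | ⟦termForm⟧ s ρ | ⟦termForm⟧ t ρ =
  mk⇔ (ℤ.drop‿+≤+ ∘ ℤ.0≤i-j⇒j≤i) (ℤ.i≤j⇒0≤j-i ∘ +≤+)

toDNF : Formula m → DNF m
toDNF (s ≈ᶠ t) = [ s ≤ᴸ t ∷ t ≤ᴸ s ∷ [] ]
toDNF (s ≤ᶠ t) = [ [ s ≤ᴸ t ] ]
toDNF ⊤ᶠ       = [ [] ]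
toDNF ⊥ᶠ       = []
toDNF (¬ᶠ φ)   = ¬ᴰ (toDNF φ)
toDNF (φ ∧ᶠ ψ) = toDNF φ ∧ᴰ toDNF ψ
toDNF (φ ∨ᶠ ψ) = toDNF φ ++ toDNF ψ
toDNF (φ ⇒ᶠ ψ) = ¬ᴰ (toDNF φ) ++ toDNF ψ
toDNF (∃ᶠ φ)   = eliminateᴰ (toDNF φ)
toDNF (∀ᶠ φ)   = ¬ᴰ (eliminateᴰ (¬ᴰ (toDNF φ)))

toDNF-correct : ∀ (φ : Formula m) ρ → (ρ ⊨ᴰ toDNF φ) ⇔ ⟦ φ ⟧ ρ
toDNF-correct (s ≈ᶠ t) ρ = mk⇔
  (λ { (here (s≤t ∷ t≤s ∷ [])) → ℕ.≤-antisym (to (≤ᴸ-correct s t ρ) s≤t) (to (≤ᴸ-correct t s ρ) t≤s) })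
  (λ s≡t → here (from (≤ᴸ-correct s t ρ) (ℕ.≤-reflexive s≡t) ∷
                 from (≤ᴸ-correct t s ρ) (ℕ.≤-reflexive (sym s≡t)) ∷ []))
toDNF-correct (s ≤ᶠ t) ρ = mk⇔ (λ { (here (s≤t ∷ [])) → to (≤ᴸ-correct s t ρ) s≤t })
                                (λ s≤t → here (from (≤ᴸ-correct s t ρ) s≤t ∷ []))
toDNF-correct ⊤ᶠ ρ = mk⇔ (λ _ → tt) (λ _ → here [])
toDNF-correct ⊥ᶠ ρ = mk⇔ (λ ()) (λ ())
toDNF-correct (¬ᶠ φ) ρ = begin
  ρ ⊨ᴰ ¬ᴰ (toDNF φ)  ∼⟨ ¬ᴰ-correct (toDNF φ) ρ ⟩
  (¬ ρ ⊨ᴰ toDNF φ)   ∼⟨ ¬-cong-⇔ (toDNF-correct φ ρ) ⟩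
  (¬ ⟦ φ ⟧ ρ)        ∎
  where open EquationalReasoning
toDNF-correct (φ ∧ᶠ ψ) ρ = begin
  ρ ⊨ᴰ toDNF φ ∧ᴰ toDNF ψ            ∼⟨ ∧ᴰ-correct (toDNF φ) (toDNF ψ) ρ ⟩
  (ρ ⊨ᴰ toDNF φ × ρ ⊨ᴰ toDNF ψ)      ∼⟨ toDNF-correct φ ρ ×-⇔ toDNF-correct ψ ρ ⟩
  (⟦ φ ⟧ ρ × ⟦ ψ ⟧ ρ)                ∎
  where open EquationalReasoning
toDNF-correct (φ ∨ᶠ ψ) ρ = begin
  ρ ⊨ᴰ toDNF φ ++ toDNF ψ            ∼⟨ ∨ᴰ-correct (toDNF φ) (toDNF ψ) ρ ⟩
  (ρ ⊨ᴰ toDNF φ ⊎ ρ ⊨ᴰ toDNF ψ)      ∼⟨ toDNF-correct φ ρ ⊎-⇔ toDNF-correct ψ ρ ⟩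
  (⟦ φ ⟧ ρ ⊎ ⟦ ψ ⟧ ρ)                ∎
  where open EquationalReasoning
toDNF-correct (φ ⇒ᶠ ψ) ρ = begin
  ρ ⊨ᴰ ¬ᴰ (toDNF φ) ++ toDNF ψ          ∼⟨ ∨ᴰ-correct (¬ᴰ (toDNF φ)) (toDNF ψ) ρ ⟩
  (ρ ⊨ᴰ ¬ᴰ (toDNF φ) ⊎ ρ ⊨ᴰ toDNF ψ)    ∼⟨ ¬ᴰ-correct (toDNF φ) ρ ⊎-⇔ ⇔.refl ⟩
  (¬ ρ ⊨ᴰ toDNF φ ⊎ ρ ⊨ᴰ toDNF ψ)       ∼⟨ ¬⊎⇔→ (⊨ᴰ? ρ (toDNF φ)) ⟩
  (ρ ⊨ᴰ toDNF φ → ρ ⊨ᴰ toDNF ψ)         ∼⟨ →-cong-⇔ (toDNF-correct φ ρ) (toDNF-correct ψ ρ) ⟩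
  (⟦ φ ⟧ ρ → ⟦ ψ ⟧ ρ)                   ∎
  where open EquationalReasoning
toDNF-correct (∃ᶠ φ) ρ = begin
  ρ ⊨ᴰ eliminateᴰ (toDNF φ)             ∼⟨ eliminateᴰ-correct (toDNF φ) ρ ⟩
  (∃ λ x → ρ ▸ x ⊨ᴰ toDNF φ)            ∼⟨ Σ.congˡ (toDNF-correct φ (ρ ▸ _)) ⟩
  (∃ λ x → ⟦ φ ⟧ (ρ ▸ x))               ∎
  where open EquationalReasoning
toDNF-correct (∀ᶠ φ) ρ = begin
  ρ ⊨ᴰ ¬ᴰ (eliminateᴰ (¬ᴰ (toDNF φ)))   ∼⟨ ¬ᴰ-correct (eliminateᴰ (¬ᴰ (toDNF φ))) ρ ⟩
  (¬ ρ ⊨ᴰ eliminateᴰ (¬ᴰ (toDNF φ)))    ∼⟨ ¬-cong-⇔ (eliminateᴰ-correct (¬ᴰ (toDNF φ)) ρ) ⟩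
  (¬ (∃ λ x → ρ ▸ x ⊨ᴰ ¬ᴰ (toDNF φ)))   ∼⟨ ¬-cong-⇔ (Σ.congˡ (¬ᴰ-correct (toDNF φ) (ρ ▸ _))) ⟩
  (¬ (∃ λ x → ¬ ρ ▸ x ⊨ᴰ toDNF φ))      ∼⟨ ¬∃¬⇔∀ (λ x → ⊨ᴰ? (ρ ▸ x) (toDNF φ)) ⟩
  (∀ x → ρ ▸ x ⊨ᴰ toDNF φ)              ∼⟨ Π-cong-⇔ (λ x → toDNF-correct φ (ρ ▸ x)) ⟩
  (∀ x → ⟦ φ ⟧ (ρ ▸ x))                 ∎
  where open EquationalReasoning

-- Presburger-definable subsets of ℕ are eventually periodic

0<y+k : ∀ k y → ∣ k ∣ ℕ.< y → 0ℤ < + y + k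
0<y+k (+ n)    y ∣k∣<y = +<+ (ℕ.<-≤-trans (ℕ.≤-<-trans ℕ.z≤n ∣k∣<y) (ℕ.m≤m+n y n))
0<y+k -[1+ n ] y ∣k∣<y rewrite ℤ.⊖-≥ (ℕ.<⇒≤ ∣k∣<y) = +<+ (ℕ.m<n⇒0<n∸m ∣k∣<y)

0<[1+b]y+k : ∀ b k y → ∣ k ∣ ℕ.< y → 0ℤ < + suc b * + y + k
0<[1+b]y+k b k y ∣k∣<y = subst (0ℤ <_) (sym (lemma (+ b) (+ y) k))
  (ℤ.+-mono-<-≤ (0<y+k k y ∣k∣<y) (subst (0ℤ ≤_) (ℤ.pos-* b y) (+≤+ ℕ.z≤n)))
  where
  lemma : ∀ b y k → (1ℤ + b) * y + k ≡ (y + k) + b * y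
  lemma = solve-∀

0≰-[1+b]y+k : ∀ b k y → ∣ k ∣ ℕ.< y → ¬ (0ℤ ≤ -[1+ b ] * + y + k)
0≰-[1+b]y+k b k y ∣k∣<y = subst (λ v → ¬ (0ℤ ≤ v)) (sym (lemma (+ suc b) (+ y) k))
  (ℤ.<⇒≱ (ℤ.neg-mono-< (0<[1+b]y+k b (- k) y (subst (ℕ._< y) (sym (ℤ.∣-i∣≡∣i∣ k)) ∣k∣<y))))
  where
  lemma : ∀ S y k → (- S) * y + k ≡ - (S * y + - k)
  lemma = solve-∀

shift-up : ∀ c x w k → c * + (x ℕ.+ w) + k ≡ (c * + x + k) + c * + w
shift-up c x w k rewrite ℤ.pos-+ x w = lemma c (+ x) (+ w) k
  where
  lemma : ∀ c x w k → c * (x + w) + k ≡ (c * x + k) + c * w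
  lemma = solve-∀

Holds-periodic : ∀ κ c k x w → ∣ k ∣ ℕ.< x → modulus κ ∣ℕ w →
                 Holds κ (c * + x + k) ⇔ Holds κ (c * + (x ℕ.+ w) + k)
Holds-periodic nonNeg (+ suc b) k x w ∣k∣<x _ = mk⇔
  (λ _ → ℤ.<⇒≤ (0<[1+b]y+k b k (x ℕ.+ w) (ℕ.<-≤-trans ∣k∣<x (ℕ.m≤m+n x w))))
  (λ _ → ℤ.<⇒≤ (0<[1+b]y+k b k x ∣k∣<x))
Holds-periodic nonNeg (+ zero)  k x w _ _ = mk⇔ id id
Holds-periodic nonNeg -[1+ b ]  k x w ∣k∣<x _ = mk⇔
  (λ 0≤v → ⊥-elim (0≰-[1+b]y+k b k x ∣k∣<x 0≤v))
  (λ 0≤v → ⊥-elim (0≰-[1+b]y+k b k (x ℕ.+ w) (ℕ.<-≤-trans ∣k∣<x (ℕ.m≤m+n x w)) 0≤v))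
Holds-periodic (dvd d)  c k x w _ d∣w rewrite shift-up c x w k = mk⇔
  (λ d∣v → ℤ∣.∣m∣n⇒∣m+n d∣v (ℤ∣.∣n⇒∣m*n c (ℤ∣.∣ᵤ⇒∣ d∣w)))
  (λ d∣v+cw → ℤ∣.∣m+n∣n⇒∣m d∣v+cw (ℤ∣.∣n⇒∣m*n c (ℤ∣.∣ᵤ⇒∣ d∣w)))
Holds-periodic (ndvd d) c k x w _ d∣w rewrite shift-up c x w k = mk⇔
  (λ d∤v d∣v+cw → d∤v (ℤ∣.∣m+n∣n⇒∣m d∣v+cw (ℤ∣.∣n⇒∣m*n c (ℤ∣.∣ᵤ⇒∣ d∣w))))
  (λ d∤v+cw d∣v → d∤v+cw (ℤ∣.∣m∣n⇒∣m+n d∣v (ℤ∣.∣n⇒∣m*n c (ℤ∣.∣ᵤ⇒∣ d∣w))))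

literal-periodic : ∀ (ℓ : Literal 1) x w → ∣ LinearForm.const (form ℓ) ∣ ℕ.< x →
                   modulus (constraint ℓ) ∣ℕ w → ((λ _ → x) ⊨ ℓ) ⇔ ((λ _ → x ℕ.+ w) ⊨ ℓ)
literal-periodic (lit κ (linear (c ∷ []) k)) x w
  rewrite ℤ.+-identityʳ (c * + x) | ℤ.+-identityʳ (c * + (x ℕ.+ w)) = Holds-periodic κ c k x w

bound : DNF 1 → ℕ
bound D = max 0 (List.map (∣_∣ ∘ LinearForm.const ∘ form) (List.concat D))

DNF-periodic : ∀ (D : DNF 1) x j → bound D ℕ.< x →
               ((λ _ → x) ⊨ᴰ D) ⇔ ((λ _ → x ℕ.+ j ℕ.* period (List.concat D)) ⊨ᴰ D)
DNF-periodic D x j bound<x =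
  Any-cong-⇔ (All.map All-cong-⇔
    (All.concat⁻ (All.zipWith (λ {ℓ} → each {ℓ}) (constants≤bound , moduli∣period))))
  where
  literals : Conjunction 1
  literals = List.concat D
  constants≤bound : All (λ ℓ → ∣ LinearForm.const (form ℓ) ∣ ℕ.≤ bound D) literals
  constants≤bound = All.map⁻ (xs≤max 0 (List.map (∣_∣ ∘ LinearForm.const ∘ form) literals))
  moduli∣period : All (λ ℓ → modulus (constraint ℓ) ∣ℕ j ℕ.* period literals) literals
  moduli∣period = All.map (ℕ∣.∣n⇒∣m*n j) (modulus∣period literals)
  each : ∀ {ℓ} → ∣ LinearForm.const (form ℓ) ∣ ℕ.≤ bound D ×
                 modulus (constraint ℓ) ∣ℕ j ℕ.* period literals →
         ((λ _ → x) ⊨ ℓ) ⇔ ((λ _ → x ℕ.+ j ℕ.* period literals) ⊨ ℓ)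
  each {ℓ} (k≤b , ℓ∣jP) = literal-periodic ℓ x _ (ℕ.≤-<-trans k≤b bound<x) ℓ∣jP

definable⇒eventuallyPeriodic :
  ∀ (φ : Formula 1) → ∃ λ N → ∃ λ P → ℕ.NonZero P ×
    (∀ x j → N ℕ.< x → ⟦ φ ⟧ (λ _ → x) ⇔ ⟦ φ ⟧ (λ _ → x ℕ.+ j ℕ.* P))
definable⇒eventuallyPeriodic φ =
  bound D , period (List.concat D) , period≢0 (List.concat D) , λ x j N<x → begin
    ⟦ φ ⟧ (λ _ → x)                                     ∼⟨ ⇔.sym (toDNF-correct φ _) ⟩
    ((λ _ → x) ⊨ᴰ D)                                    ∼⟨ DNF-periodic D x j N<x ⟩
    ((λ _ → x ℕ.+ j ℕ.* period (List.concat D)) ⊨ᴰ D)   ∼⟨ toDNF-correct φ _ ⟩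
    ⟦ φ ⟧ (λ _ → x ℕ.+ j ℕ.* period (List.concat D))    ∎
  where
  open EquationalReasoning
  D : DNF 1
  D = toDNF φ

-- The equation y a b x = x a b y

a b : Fin 2
a = zero
b = suc zero

X Y : Fin 2
X = zero
Y = suc zero

yabx≐xaby : WordEquation 2 2
yabx≐xaby = (inj₂ Y ∷ inj₁ a ∷ inj₁ b ∷ inj₂ X ∷ []) ≐ (inj₂ X ∷ inj₁ a ∷ inj₁ b ∷ inj₂ Y ∷ [])

yabx≐xaby-quadratic : Quadratic yabx≐xaby
yabx≐xaby-quadratic zero       = ℕ.≤-refl
yabx≐xaby-quadratic (suc zero) = ℕ.≤-refl

yabx≐xaby-allVariablesOccur : AllVariablesOccur yabx≐xaby
yabx≐xaby-allVariablesOccur zero       = there (there (there (here refl)))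
yabx≐xaby-allVariablesOccur (suc zero) = here refl

abx-aby-commute : ∀ σ → IsSolution yabx≐xaby σ →
                  (a ∷ b ∷ σ X) ++ (a ∷ b ∷ σ Y) ≡ (a ∷ b ∷ σ Y) ++ (a ∷ b ∷ σ X)
abx-aby-commute σ sol = cong (λ w → a ∷ b ∷ w) (sym (subst₂ (λ u v → σ Y ++ a ∷ b ∷ u ≡ σ X ++ a ∷ b ∷ v)
                                                            (List.++-identityʳ (σ X))
                                                            (List.++-identityʳ (σ Y)) sol))

solution⇒commonFactor : ∀ σ → IsSolution yabx≐xaby σ →
  ∃ λ d → 2 ℕ.≤ d × d ∣ℕ 2 ℕ.+ length (σ X) × d ∣ℕ 2 ℕ.+ length (σ Y)
solution⇒commonFactor σ sol with commute⇒commonRoot (a ∷ b ∷ σ X) (a ∷ b ∷ σ Y) (abx-aby-commute σ sol)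
... | z , i , j , abx≡zⁱ , aby≡zʲ =
  length z , root-length≥2 (σ X) z i (λ ()) abx≡zⁱ ,
  ℕ∣.divides i (trans (cong length abx≡zⁱ) (length-^ z i)) ,
  ℕ∣.divides j (trans (cong length aby≡zʲ) (length-^ z j))

Len⇒¬prime : ∀ v → Len yabx≐xaby v → v X ℕ.< v Y → ¬ Prime (2 ℕ.+ v Y)
Len⇒¬prime v (σ , sol , lengths) x<y y+2-prime with solution⇒commonFactor σ sol
... | d , 2≤d , d∣x+2 , d∣y+2 rewrite lengths X | lengths Y
  with prime⇒irreducible y+2-prime d∣y+2
... | inj₁ refl = ℕ.<⇒≱ ℕ.≤-refl 2≤d
... | inj₂ refl = ℕ.<⇒≱ (ℕ.s≤s (ℕ.s≤s x<y)) (ℕ∣.∣⇒≤ d∣x+2)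

solution : ℕ → ℕ → Assignment 2 2
solution e n zero       = replicate e a
solution e n (suc zero) = (replicate e a ++ a ∷ b ∷ []) ^ n ++ replicate e a

solution-correct : ∀ e n → IsSolution yabx≐xaby (solution e n)
solution-correct e n = begin
  (r ^ n ++ s) ++ a ∷ b ∷ (s ++ [])   ≡⟨ cong (λ w → (r ^ n ++ s) ++ a ∷ b ∷ w) (List.++-identityʳ s) ⟩
  (r ^ n ++ s) ++ a ∷ b ∷ s           ≡⟨ List.++-assoc (r ^ n) s (a ∷ b ∷ s) ⟩
  r ^ n ++ (s ++ a ∷ b ∷ s)           ≡⟨ cong (r ^ n ++_) (List.++-assoc s (a ∷ b ∷ []) s) ⟨
  r ^ n ++ (r ++ s)                   ≡⟨ List.++-assoc (r ^ n) r s ⟨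
  (r ^ n ++ r) ++ s                   ≡⟨ cong (_++ s) (^-comm r n) ⟩
  (r ++ r ^ n) ++ s                   ≡⟨ List.++-assoc r (r ^ n) s ⟩
  r ++ (r ^ n ++ s)                   ≡⟨ List.++-assoc s (a ∷ b ∷ []) (r ^ n ++ s) ⟩
  s ++ a ∷ b ∷ (r ^ n ++ s)           ≡⟨ cong (λ w → s ++ a ∷ b ∷ w) (List.++-identityʳ (r ^ n ++ s)) ⟨
  s ++ a ∷ b ∷ ((r ^ n ++ s) ++ [])   ∎
  where
  open ≡-Reasoning
  s r : List (Fin 2)
  s = replicate e a
  r = s ++ a ∷ b ∷ []

solution∈Len : ∀ e n v → v X ≡ e → v Y ≡ n ℕ.* (2 ℕ.+ e) ℕ.+ e → Len yabx≐xaby v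
solution∈Len e n v vX≡e vY≡n[2+e]+e = solution e n , solution-correct e n , lengths
  where
  lengths : ∀ i → length (solution e n i) ≡ v i
  lengths zero       = trans (List.length-replicate e) (sym vX≡e)
  lengths (suc zero) = begin
    length ((s ++ a ∷ b ∷ []) ^ n ++ s)               ≡⟨ List.length-++ ((s ++ a ∷ b ∷ []) ^ n) ⟩
    length ((s ++ a ∷ b ∷ []) ^ n) ℕ.+ length s        ≡⟨ cong₂ ℕ._+_ (length-^ (s ++ a ∷ b ∷ []) n)
                                                                         (List.length-replicate e) ⟩
    n ℕ.* length (s ++ a ∷ b ∷ []) ℕ.+ e              ≡⟨ cong (λ l → n ℕ.* l ℕ.+ e) (List.length-++ s) ⟩
    n ℕ.* (length s ℕ.+ 2) ℕ.+ e                      ≡⟨ cong (λ l → n ℕ.* (l ℕ.+ 2) ℕ.+ e)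
                                                              (List.length-replicate e) ⟩
    n ℕ.* (e ℕ.+ 2) ℕ.+ e                             ≡⟨ cong (λ l → n ℕ.* l ℕ.+ e) (ℕ.+-comm e 2) ⟩
    n ℕ.* (2 ℕ.+ e) ℕ.+ e                             ≡⟨ sym vY≡n[2+e]+e ⟩
    v Y                                               ∎
    where
    open ≡-Reasoning
    s : List (Fin 2)
    s = replicate e a

-- With var zero bound to a and var (suc zero) to p: ∃ a < p. φ (a , p).
smallerPartner : Formula 2 → Formula 1
smallerPartner φ = ∃ᶠ (φ ∧ᶠ (¬ᶠ (var (suc zero) ≤ᶠ var zero)))

Len-notPresburgerDefinable : ¬ PresburgerDefinable (Len yabx≐xaby)
Len-notPresburgerDefinable (φ , φ-defines) with definable⇒eventuallyPeriodic (smallerPartner φ)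
... | N , P , P≢0 , periodic with prime> (2 ℕ.+ N)
... | suc (suc p) , ℕ.s≤s (ℕ.s≤s N<p) , p+2-prime = ¬partner (from (periodic p (2 ℕ.+ p) N<p) partner)
  where
  ¬partner : ¬ ⟦ smallerPartner φ ⟧ (λ _ → p)
  ¬partner (a , φ-holds , p≰a) =
    Len⇒¬prime ((λ _ → p) ▸ a) (from (φ-defines _) φ-holds) (ℕ.≰⇒> p≰a) p+2-prime
  partner : ⟦ smallerPartner φ ⟧ (λ _ → p ℕ.+ (2 ℕ.+ p) ℕ.* P)
  partner = p , to (φ-defines _) (solution∈Len p P _ refl shape) , ℕ.<⇒≱ (ℕ.m<m+n p 0<[2+p]P)
    where
    shape : p ℕ.+ (2 ℕ.+ p) ℕ.* P ≡ P ℕ.* (2 ℕ.+ p) ℕ.+ p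
    shape = trans (ℕ.+-comm p _) (cong (ℕ._+ p) (ℕ.*-comm (2 ℕ.+ p) P))
    0<[2+p]P : 0 ℕ.< (2 ℕ.+ p) ℕ.* P
    0<[2+p]P = ℕ.>-nonZero⁻¹ _ {{ℕ.m*n≢0 (2 ℕ.+ p) P {{_}} {{P≢0}}}}

theorem1 : Σ ℕ λ n → Σ ℕ λ k → Σ (WordEquation n k) λ E →
             Quadratic E × AllVariablesOccur E × ¬ PresburgerDefinable (Len E)
theorem1 =
  2 , 2 , yabx≐xaby , yabx≐xaby-quadratic , yabx≐xaby-allVariablesOccur , Len-notPresburgerDefinable
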